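{- Let $w$ be a word over an alphabet $\Sigma$ and let $x,y,z\in\Sigma$ be pairwise distinct letters. If between any two occurrences of $y$ in $w$ there is an occurrence of $z$, then $\mathrm{inter}_w(x,z)\ge\lfloor \mathrm{inter}_w(x,y)/2\rfloor$.
   Context: A subword of a word $w$ is a word obtained from $w$ by deleting some letters (not necessarily contiguous). For distinct letters $a,b$, $\mathrm{inter}_w(a,b)$ is the largest $t$ such that $w$ contains as a subword the $t$-fold concatenation $abab\cdots ab$ of $ab$. -}

module Defs where

open import Data.Nat using (ℕ; zero; suc; _<_; _≤_)
open import Data.List using (List; []; _∷_; _++_; length; lookup)
open import Data.Fin using (Fin; toℕ)
open import Data.Product using (∃-syntax; _×_)
open import Relation.Binary.PropositionalEquality using (_≡_)
open import Data.List.Relation.Binary.Sublist.Propositional using (_⊆_)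

alt : {A : Set} → A → A → ℕ → List A
alt a b zero    = []
alt a b (suc t) = a ∷ b ∷ alt a b t

AltSub : {A : Set} → List A → A → A → ℕ → Set
AltSub w a b t = alt a b t ⊆ w

IsInter : {A : Set} → List A → A → A → ℕ → Set
IsInter w a b t = AltSub w a b t × (∀ s → AltSub w a b s → s ≤ t)

Separated : {A : Set} → List A → A → A → Set
Separated w y z =
  (i j : Fin (length w)) → toℕ i < toℕ j → lookup w i ≡ y → lookup w j ≡ y →
  ∃[ k ] (toℕ i < toℕ k × toℕ k < toℕ j × lookup w k ≡ z)

-- If (xy)^(2k) is a subword of w, then so is (xyy)^k. Each pair yy in that
-- subword has a z between its two letters, so replacing every pair yy by
-- such a z, from left to right, embeds (xz)^k in w.
module Submission where

open import Defs
open import Data.Nat using (ℕ; zero; suc; _≤_; _<_; _/_; _*_; z≤n; s≤s)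
open import Data.Nat.DivMod using (m/n*n≤m)
open import Data.List using (List; _∷_; length; lookup)
open import Data.List.Relation.Unary.Any using (index)
open import Data.List.Relation.Unary.Any.Properties using (lookup-index)
open import Data.List.Relation.Binary.Sublist.Propositional
  using (_⊆_; _∷_; _∷ʳ_; ⊆-refl; ⊆-trans; minimum; to∈)
open import Data.Fin using (Fin; toℕ; zero; suc)
open import Data.Product using (_,_)
open import Relation.Binary.PropositionalEquality using (_≡_; refl; sym; subst)
open import Relation.Nullary using (¬_)

Entails : {A : Set} → (List A → Set) → List A → List A → Set
Entails P R S = ∀ {w} → P w → R ⊆ w → S ⊆ w

module SuffixClosed {A : Set} {P : List A → Set} (P-tail : ∀ {a w} → P (a ∷ w) → P w) where

  entails-at-match : ∀ {a R S} →
    (∀ {v} → P (a ∷ v) → R ⊆ v → S ⊆ (a ∷ v)) → Entails P (a ∷ R) S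
  entails-at-match f s (b ∷ʳ p)   = b ∷ʳ entails-at-match f (P-tail s) p
  entails-at-match f s (refl ∷ p) = f s p

  entails-∷ : ∀ {a R S} → Entails P R S → Entails P (a ∷ R) (a ∷ S)
  entails-∷ f = entails-at-match λ s p → refl ∷ f (P-tail s) p

⊆-lookup-before : {A : Set} {a : A} {R w : List A} (p : (a ∷ R) ⊆ w)
  (k : Fin (length w)) → toℕ k < toℕ (index (to∈ p)) → (lookup w k ∷ a ∷ R) ⊆ w
⊆-lookup-before (b ∷ʳ p) zero    _         = refl ∷ p
⊆-lookup-before (b ∷ʳ p) (suc k) (s≤s k<i) = b ∷ʳ ⊆-lookup-before p k k<i
⊆-lookup-before (refl ∷ p) k ()

module _ {A : Set} {y z : A} where

  Separated-tail : ∀ {a w} → Separated (a ∷ w) y z → Separated w y z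
  Separated-tail s i j i<j wᵢ≡y wⱼ≡y with s (suc i) (suc j) (s≤s i<j) wᵢ≡y wⱼ≡y
  ... | zero  , ()      , _
  ... | suc k , s≤s i<k , s≤s k<j , wₖ≡z = k , i<k , k<j , wₖ≡z

  open SuffixClosed {P = λ w → Separated w y z} Separated-tail

  separator-⊆ : ∀ {R w} → Separated (y ∷ w) y z → (y ∷ R) ⊆ w → (z ∷ y ∷ R) ⊆ w
  separator-⊆ s p
    with s zero (suc (index (to∈ p))) (s≤s z≤n) refl (sym (lookup-index (to∈ p)))
  ... | zero  , ()  , _
  ... | suc k , _ , s≤s k<i , wₖ≡z = subst (λ c → (c ∷ _) ⊆ _) wₖ≡z (⊆-lookup-before p k k<i)

  entails-yy : ∀ {R S} → Entails (λ w → Separated w y z) R S →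
    Entails (λ w → Separated w y z) (y ∷ y ∷ R) (z ∷ S)
  entails-yy f = entails-at-match λ s p →
    y ∷ʳ entails-∷ f (Separated-tail s) (drop-second (separator-⊆ s p))
    where
    drop-second : ∀ {a b : A} {R w} → (a ∷ b ∷ R) ⊆ w → (a ∷ R) ⊆ w
    drop-second = ⊆-trans (refl ∷ _ ∷ʳ ⊆-refl)

  alt-double-entails : (x : A) (k : ℕ) →
    Entails (λ w → Separated w y z) (alt x y (k * 2)) (alt x z k)
  alt-double-entails x zero    _ _ = minimum _
  alt-double-entails x (suc k) s p =
    entails-∷ (entails-yy (alt-double-entails x k)) s (⊆-trans xyy⊆xyxy p)
    where
    xyy⊆xyxy : (x ∷ y ∷ y ∷ alt x y (k * 2)) ⊆ alt x y (suc k * 2)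
    xyy⊆xyxy = refl ∷ refl ∷ x ∷ʳ ⊆-refl

alt-mono : {A : Set} (a b : A) {m n : ℕ} → m ≤ n → alt a b m ⊆ alt a b n
alt-mono a b z≤n       = minimum _
alt-mono a b (s≤s m≤n) = refl ∷ refl ∷ alt-mono a b m≤n

lemma4p3 : {A : Set} (w : List A) (x y z : A) →
    ¬ x ≡ y → ¬ y ≡ z → ¬ x ≡ z →
    Separated w y z →
    (p q : ℕ) → IsInter w x y p → IsInter w x z q →
    p / 2 ≤ q
lemma4p3 w x y z _ _ _ sep p q (xy-p⊆w , _) (_ , xz-max) =
  xz-max (p / 2) (alt-double-entails x (p / 2) sep xy-⊆w)
  where
  xy-⊆w : alt x y (p / 2 * 2) ⊆ w
  xy-⊆w = ⊆-trans (alt-mono x y (m/n*n≤m p 2)) xy-p⊆w
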